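{- Let $G$ be a finite abelian group of odd order $n$ with $n>1$ (equivalently, $G$ nontrivial and the center of $D(G)$ is trivial), and let $\Gamma=\mathfrak{C}(D(G),D(G))$. Then the resolving polynomial of $\Gamma$ is \[\beta(\Gamma,x)=x^{2n-3}\big(x^3+2nx^2+(n^2+n-1)x+n(n-1)\big).\]
   Context: $D(G)=G\rtimes C_2$, $C_2=\{1,-1\}$, has elements $(g,c)$ with multiplication $(g_1,c_1)(g_2,c_2)=(g_1g_2^{c_1},c_1c_2)$; its center is $\{(g,1):g^2=e\}$, which is trivial exactly when $|G|$ is odd. The commuting graph $\mathfrak{C}(D(G),D(G))$ is the simple graph with vertex set $D(G)$ in which distinct $u,v$ are adjacent iff $uv=vu$. A set $W$ of vertices of a connected graph is resolving if every vertex is uniquely determined by its vector of shortest-path distances to the vertices of $W$; $\beta(\Gamma)$ is the minimum size of a resolving set. The resolving polynomial is $\beta(\Gamma,x)=\sum_{i=\beta(\Gamma)}^{|V(\Gamma)|}s_ix^i$, where $s_i$ is the number of resolving sets of $\Gamma$ of cardinality $i$. -}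

module Defs where

open import Data.Nat using (ℕ; zero; suc; _+_; _*_; _∸_; _<_)
open import Data.Fin using (Fin)
open import Data.Fin.Subset using (Subset; _∈_; ∣_∣)
open import Data.Bool using (Bool; true; false; not; _xor_; if_then_else_)
open import Data.Product using (Σ; _×_; _,_)
open import Data.List using (List; []; _∷_; replicate; _++_; length)
import Data.List.Membership.Propositional as LM
open import Data.List.Relation.Unary.Unique.Propositional using (Unique)
open import Algebra.Core using (Op₁; Op₂)
open import Relation.Binary.PropositionalEquality using (_≡_; _≢_)
open import Relation.Nullary using (¬_)
open import Function.Bundles using (_⇔_)

-- Polynomials with natural-number coefficients, as coefficient lists
-- (constant term first); coefficients beyond the list are 0.

Poly : Set
Poly = List ℕ

coeff : Poly → ℕ → ℕ
coeff []       _       = 0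
coeff (a ∷ p)  zero    = a
coeff (a ∷ p)  (suc i) = coeff p i

x^_·_ : ℕ → Poly → Poly
x^ k · p = replicate k 0 ++ p

resolvingPolyRHS : ℕ → Poly
resolvingPolyRHS n =
  x^ (2 * n ∸ 3) · (n * (n ∸ 1) ∷ (n * n + n ∸ 1) ∷ 2 * n ∷ 1 ∷ [])

-- The generalized dihedral group D(G) = G ⋊ C₂ of a group G whose
-- carrier is Fin n, and its commuting graph.
-- C₂ = {1,-1} is encoded by Bool: true = 1, false = -1.

module Dihedral {n : ℕ} (_∙_ : Op₂ (Fin n)) (_⁻¹ : Op₁ (Fin n)) where

  Vertex : Set
  Vertex = Fin n × Bool

  pow : Fin n → Bool → Fin n
  pow g true  = g
  pow g false = g ⁻¹

  -- (g₁,c₁)(g₂,c₂) = (g₁ g₂^{c₁}, c₁c₂)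
  _·_ : Vertex → Vertex → Vertex
  (g₁ , c₁) · (g₂ , c₂) = (g₁ ∙ pow g₂ c₁ , not (c₁ xor c₂))

  Adj : Vertex → Vertex → Set
  Adj u v = u ≢ v × (u · v ≡ v · u)

  data Walk : Vertex → Vertex → ℕ → Set where
    here : ∀ {u} → Walk u u 0
    step : ∀ {u w v k} → Adj u w → Walk w v k → Walk u v (suc k)

  Dist : Vertex → Vertex → ℕ → Set
  Dist u v k = Walk u v k × (∀ m → m < k → ¬ Walk u v m)

  -- a set of vertices W ⊆ D(G): (g,1) ∈ W iff g ∈ proj₁ W,
  -- (g,-1) ∈ W iff g ∈ proj₂ W
  VSet : Set
  VSet = Subset n × Subset n

  _∈V_ : Vertex → VSet → Set
  (g , true)  ∈V (A , B) = g ∈ A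
  (g , false) ∈V (A , B) = g ∈ B

  size : VSet → ℕ
  size (A , B) = ∣ A ∣ + ∣ B ∣

  Resolving : VSet → Set
  Resolving W = ∀ u v →
    (∀ w → w ∈V W → ∀ k → (Dist u w k ⇔ Dist v w k)) → u ≡ v

  NumResolvingSets : ℕ → ℕ → Set
  NumResolvingSets i s =
    Σ (List VSet) λ L →
      Unique L × (∀ W → (W LM.∈ L) ⇔ (Resolving W × size W ≡ i)) × length L ≡ s

module Submission where

-- The commuting graph Γ of D(G) = G ⋊ C₂, for G abelian of odd order n ≥ 3, is explicit:
-- the rotations (g,1) form a clique, the identity (ε,1) is adjacent to every vertex,
-- distinct reflections (h,-1) are never adjacent and a rotation g ≠ ε commutes with no
-- reflection (both because G has no element of order 2).  Hence Γ has diameter 2 and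
-- d(u,v) ∈ {0,1,2} is read off from adjacency.
--
-- Non-identity rotations are pairwise twins, and so are reflections; therefore a set
-- W = (A,B) of rotations A and reflections B is resolving iff A misses at most one
-- non-identity rotation and B misses at most one reflection (for sufficiency, the
-- distances to one non-identity rotation and one reflection of W tell the identity,
-- the other rotations and the other reflections apart).  Such A are ⊤, ⊤ - g (n of
-- them) and ⊤ - ε - g with g ≠ ε (n - 1 of them); such B are ⊤ and ⊤ - g (n of them).
-- Counting pairs by size gives the coefficients of
--   (x^n + n x^(n-1) + (n-1) x^(n-2)) (x^n + n x^(n-1)) = x^(2n-3) (x³ + 2n x² + (n²+n-1) x + n(n-1)).

open import Defs
open import Data.Nat using (ℕ; zero; suc; _+_; _*_; _∸_; _<_; s≤s; z≤n)
open import Data.Nat.Divisibility using (_∣_; divides)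
open import Data.Fin using (Fin; zero; suc; toℕ; punchIn)
open import Data.Fin.Subset using (Subset; _∈_; _∉_; ⊤; ⁅_⁆; _-_; ∣_∣; inside; outside)
open import Data.Bool using (Bool; true; false; if_then_else_)
open import Data.Product using (Σ-syntax; _×_; _,_; proj₁; proj₂)
open import Data.Sum using (inj₁; inj₂)
open import Data.Unit using () renaming (⊤ to Unit)
open import Data.List using (List; []; _∷_; map; _++_; filter; cartesianProduct; allFin; length)
open import Data.List.Membership.Propositional using () renaming (_∈_ to _∈ₗ_)
open import Data.List.Relation.Unary.Unique.Propositional using (Unique)
import Data.List.Relation.Unary.Unique.Propositional.Properties as Unique
open import Algebra.Core using (Op₁; Op₂)
open import Algebra.Structures using (IsAbelianGroup)
open import Function using (_∘_)
open import Function.Bundles using (_⇔_; mk⇔; Equivalence)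
open import Relation.Binary.PropositionalEquality
open import Relation.Nullary using (¬_; Dec; yes; no; does; contradiction)
open import Relation.Nullary.Decidable using (decidable-stable; dec-true; dec-false; ¬?; _×-dec_)

-- A fixed-point-free involution f of Fin n forces n to be even: each orbit {x, f x}
-- has exactly one element smaller than its partner, so n = 2 · #orbits.
module FixedPointFreeInvolution where
  open import Data.Fin.Properties using (toℕ-injective)
  open import Data.Fin.Permutation using (permutation)
  open import Data.Nat.Properties using (+-0-commutativeMonoid; +-identityʳ; *-comm)
  open import Algebra.Properties.CommutativeMonoid.Sum +-0-commutativeMonoid
    using (sum; sum-cong-≗; ∑-distrib-+; ∑-permute)

  lessIndicator : ℕ → ℕ → ℕ
  lessIndicator zero    zero    = 0
  lessIndicator zero    (suc k) = 1
  lessIndicator (suc m) zero    = 0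
  lessIndicator (suc m) (suc k) = lessIndicator m k

  lessIndicator-trichotomy : ∀ m k → m ≢ k → lessIndicator m k + lessIndicator k m ≡ 1
  lessIndicator-trichotomy zero    zero    m≢k = contradiction refl m≢k
  lessIndicator-trichotomy zero    (suc k) _   = refl
  lessIndicator-trichotomy (suc m) zero    _   = refl
  lessIndicator-trichotomy (suc m) (suc k) m≢k = lessIndicator-trichotomy m k (m≢k ∘ cong suc)

  sum-ones : ∀ n → sum {n} (λ _ → 1) ≡ n
  sum-ones zero    = refl
  sum-ones (suc n) = cong suc (sum-ones n)

  involution⇒even : ∀ n (f : Fin n → Fin n) → (∀ x → f (f x) ≡ x) → (∀ x → f x ≢ x) → 2 ∣ n
  involution⇒even n f involutive fixed-point-free = divides (sum smaller) (begin
      n                                      ≡⟨ sum-ones n ⟨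
      sum {n} (λ _ → 1)                      ≡⟨ sum-cong-≗ orbit-counted-once ⟨
      sum (λ x → smaller x + smaller (f x))  ≡⟨ ∑-distrib-+ smaller (smaller ∘ f) ⟩
      sum smaller + sum (smaller ∘ f)        ≡⟨ cong (sum smaller +_) (∑-permute smaller π) ⟨
      sum smaller + sum smaller              ≡⟨ cong (sum smaller +_) (+-identityʳ (sum smaller)) ⟨
      2 * sum smaller                        ≡⟨ *-comm 2 (sum smaller) ⟩
      sum smaller * 2                        ∎)
    where
    open ≡-Reasoning
    π = permutation f f involutive involutive
    smaller : Fin n → ℕ
    smaller x = lessIndicator (toℕ x) (toℕ (f x))
    orbit-counted-once : ∀ x → smaller x + smaller (f x) ≡ 1
    orbit-counted-once x rewrite involutive x =
      lessIndicator-trichotomy (toℕ x) (toℕ (f x)) (λ e → fixed-point-free x (sym (toℕ-injective e)))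

module Coefficients where
  open import Data.Nat.Properties using (_≟_; +-∸-assoc)
  open import Data.Nat.Tactic.RingSolver using (solve-∀)

  δ : ℕ → ℕ → ℕ
  δ i k = if does (k ≟ i) then 1 else 0

  private
    all-terms-vanish : ∀ c₀ c₁ c₂ c₃ → 0 ≡ c₀ * 0 + c₁ * 0 + c₂ * 0 + c₃ * 0
    all-terms-vanish = solve-∀

  coeff-shifted-cubic : ∀ K c₀ c₁ c₂ c₃ i →
    coeff (x^ K · (c₀ ∷ c₁ ∷ c₂ ∷ c₃ ∷ [])) i
      ≡ c₀ * δ i K + c₁ * δ i (K + 1) + c₂ * δ i (K + 2) + c₃ * δ i (K + 3)
  coeff-shifted-cubic (suc K) c₀ c₁ c₂ c₃ (suc i) = coeff-shifted-cubic K c₀ c₁ c₂ c₃ i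
  coeff-shifted-cubic (suc K) c₀ c₁ c₂ c₃ zero    = all-terms-vanish c₀ c₁ c₂ c₃
  coeff-shifted-cubic zero    c₀ c₁ c₂ c₃ 0       = picks c₀ c₁ c₂ c₃
    where
    picks : ∀ c₀ c₁ c₂ c₃ → c₀ ≡ c₀ * 1 + c₁ * 0 + c₂ * 0 + c₃ * 0
    picks = solve-∀
  coeff-shifted-cubic zero    c₀ c₁ c₂ c₃ 1       = picks c₀ c₁ c₂ c₃
    where
    picks : ∀ c₀ c₁ c₂ c₃ → c₁ ≡ c₀ * 0 + c₁ * 1 + c₂ * 0 + c₃ * 0
    picks = solve-∀
  coeff-shifted-cubic zero    c₀ c₁ c₂ c₃ 2       = picks c₀ c₁ c₂ c₃
    where
    picks : ∀ c₀ c₁ c₂ c₃ → c₂ ≡ c₀ * 0 + c₁ * 0 + c₂ * 1 + c₃ * 0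
    picks = solve-∀
  coeff-shifted-cubic zero    c₀ c₁ c₂ c₃ 3       = picks c₀ c₁ c₂ c₃
    where
    picks : ∀ c₀ c₁ c₂ c₃ → c₃ ≡ c₀ * 0 + c₁ * 0 + c₂ * 0 + c₃ * 1
    picks = solve-∀
  coeff-shifted-cubic zero    c₀ c₁ c₂ c₃ (suc (suc (suc (suc i)))) = all-terms-vanish c₀ c₁ c₂ c₃

  degree-shift : ∀ m → 2 * (3 + m) ∸ 3 ≡ 3 + (m + m)
  degree-shift m = normalise m
    where
    normalise : ∀ m → m + (3 + (m + 0)) ≡ 3 + (m + m)
    normalise = solve-∀

  resolvingPoly-coeff : ∀ m i → let n = 3 + m ; K = 3 + (m + m) in
    coeff (resolvingPolyRHS n) i
      ≡ n * (2 + m) * δ i K + (n * n + (2 + m)) * δ i (K + 1) + 2 * n * δ i (K + 2) + 1 * δ i (K + 3)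
  resolvingPoly-coeff m i = begin
    coeff (x^ (2 * n ∸ 3) · (c₀ ∷ c₁ ∷ c₂ ∷ 1 ∷ [])) i
      ≡⟨ cong (λ e → coeff (x^ e · (c₀ ∷ c₁ ∷ c₂ ∷ 1 ∷ [])) i) (degree-shift m) ⟩
    coeff (x^ K · (c₀ ∷ c₁ ∷ c₂ ∷ 1 ∷ [])) i
      ≡⟨ coeff-shifted-cubic K c₀ c₁ c₂ 1 i ⟩
    c₀ * δ i K + c₁ * δ i (K + 1) + c₂ * δ i (K + 2) + 1 * δ i (K + 3)
      ≡⟨ cong (λ c → c₀ * δ i K + c * δ i (K + 1) + c₂ * δ i (K + 2) + 1 * δ i (K + 3)) linear-coefficient ⟩
    c₀ * δ i K + (n * n + (2 + m)) * δ i (K + 1) + c₂ * δ i (K + 2) + 1 * δ i (K + 3) ∎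
    where
    open ≡-Reasoning
    n K c₀ c₁ c₂ : ℕ
    n  = 3 + m
    K  = 3 + (m + m)
    c₀ = n * (n ∸ 1)
    c₁ = n * n + n ∸ 1
    c₂ = 2 * n
    linear-coefficient : c₁ ≡ n * n + (2 + m)
    linear-coefficient = +-∸-assoc (n * n) {n} {1} (s≤s z≤n)

  -- Number of pairs (a, b) with |a| + |b| = i, for a fixed |a| = s, when b ranges over
  -- one set of size n and n sets of size n - 1 (n = 3 + m).
  reflectionRow : ℕ → ℕ → ℕ → ℕ
  reflectionRow m i s = δ i (s + (3 + m)) + (3 + m) * δ i (s + (2 + m))

  -- The same count when a ranges over one set of size n, n sets of size n - 1 and
  -- n - 1 sets of size n - 2.
  pairCount : ℕ → ℕ → ℕ
  pairCount m i = reflectionRow m i (3 + m)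
    + ((3 + m) * reflectionRow m i (2 + m) + (2 + m) * reflectionRow m i (1 + m))

  sum₃₃ : ∀ m → (3 + m) + (3 + m) ≡ 3 + (m + m) + 3
  sum₃₃ = solve-∀
  sum₃₂ : ∀ m → (3 + m) + (2 + m) ≡ 3 + (m + m) + 2
  sum₃₂ = solve-∀
  sum₂₃ : ∀ m → (2 + m) + (3 + m) ≡ 3 + (m + m) + 2
  sum₂₃ = solve-∀
  sum₂₂ : ∀ m → (2 + m) + (2 + m) ≡ 3 + (m + m) + 1
  sum₂₂ = solve-∀
  sum₁₃ : ∀ m → (1 + m) + (3 + m) ≡ 3 + (m + m) + 1
  sum₁₃ = solve-∀
  sum₁₂ : ∀ m → (1 + m) + (2 + m) ≡ 3 + (m + m)
  sum₁₂ = solve-∀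

  pairCount≡coeff : ∀ m i → pairCount m i ≡ coeff (resolvingPolyRHS (3 + m)) i
  pairCount≡coeff m i
    rewrite sum₃₃ m | sum₃₂ m | sum₂₃ m | sum₂₂ m | sum₁₃ m | sum₁₂ m =
    trans (collect m (δ i K) (δ i (K + 1)) (δ i (K + 2)) (δ i (K + 3))) (sym (resolvingPoly-coeff m i))
    where
    K : ℕ
    K = 3 + (m + m)
    collect : ∀ m d₀ d₁ d₂ d₃ →
      d₃ + (3 + m) * d₂ + ((3 + m) * (d₂ + (3 + m) * d₁) + (2 + m) * (d₁ + (3 + m) * d₀))
        ≡ (3 + m) * (2 + m) * d₀ + ((3 + m) * (3 + m) + (2 + m)) * d₁ + 2 * (3 + m) * d₂ + 1 * d₃
    collect = solve-∀

module ListSums where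
  open import Level using (0ℓ)
  open import Relation.Unary using (Pred; Decidable)
  open import Data.Nat.ListAction using (sum)
  open import Data.Nat.ListAction.Properties using (sum-++)
  open import Data.List.Properties using (map-++; map-∘)
  open import Data.List.Relation.Unary.Any using (here; there)

  private variable A B : Set

  indicator : {P : Pred A 0ℓ} → Decidable P → A → ℕ
  indicator P? x = if does (P? x) then 1 else 0

  length-filter≡sum : ∀ {P : Pred A 0ℓ} (P? : Decidable P) xs →
    length (filter P? xs) ≡ sum (map (indicator P?) xs)
  length-filter≡sum P? []       = refl
  length-filter≡sum P? (x ∷ xs) with does (P? x)
  ... | true  = cong suc (length-filter≡sum P? xs)
  ... | false = length-filter≡sum P? xs

  sum-map-++ : ∀ (f : A → ℕ) xs ys → sum (map f (xs ++ ys)) ≡ sum (map f xs) + sum (map f ys)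
  sum-map-++ f xs ys = trans (cong sum (map-++ f xs ys)) (sum-++ (map f xs) (map f ys))

  sum-map-cong : ∀ {f g : A → ℕ} xs → (∀ {x} → x ∈ₗ xs → f x ≡ g x) → sum (map f xs) ≡ sum (map g xs)
  sum-map-cong []       _   = refl
  sum-map-cong (x ∷ xs) f≡g = cong₂ _+_ (f≡g (here refl)) (sum-map-cong xs (f≡g ∘ there))

  sum-map-const : ∀ {f : A → ℕ} {c} xs → (∀ {x} → x ∈ₗ xs → f x ≡ c) → sum (map f xs) ≡ length xs * c
  sum-map-const []       _   = refl
  sum-map-const (x ∷ xs) f≡c = cong₂ _+_ (f≡c (here refl)) (sum-map-const xs (f≡c ∘ there))

  sum-cartesianProduct : ∀ (f : A × B → ℕ) xs ys →
    sum (map f (cartesianProduct xs ys)) ≡ sum (map (λ x → sum (map (λ y → f (x , y)) ys)) xs)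
  sum-cartesianProduct f []       ys = refl
  sum-cartesianProduct f (x ∷ xs) ys = begin
    sum (map f (map (x ,_) ys ++ cartesianProduct xs ys))
      ≡⟨ sum-map-++ f (map (x ,_) ys) (cartesianProduct xs ys) ⟩
    sum (map f (map (x ,_) ys)) + sum (map f (cartesianProduct xs ys))
      ≡⟨ cong₂ _+_ (sym (cong sum (map-∘ ys))) (sum-cartesianProduct f xs ys) ⟩
    sum (map (λ y → f (x , y)) ys) + sum (map (λ x → sum (map (λ y → f (x , y)) ys)) xs) ∎
    where open ≡-Reasoning

module MissingElements where
  open import Data.Fin.Properties using (_≟_; any?; punchIn-injective; punchInᵢ≢i; punchIn-punchOut)
  open import Data.Fin.Subset.Properties
    using (_∈?_; ∈⊤; ⊆-antisym; p─⊥≡p; p─q⊆p; x∈p∧x≢y⇒x∈p-y; ∣⊤∣≡n)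
  open import Data.Nat.Properties using (suc-injective; <⇒≢; ≤-reflexive; <-trans; n<1+n)
  open import Data.Vec using (_∷_; here; there)
  open import Data.List.Properties using (length-map; length-tabulate)
  open import Data.List.Membership.Propositional.Properties
    using (∈-map⁺; ∈-map⁻; ∈-++⁺ˡ; ∈-++⁺ʳ; ∈-++⁻; ∈-allFin)
  import Data.List.Relation.Unary.Any as Any
  import Data.List.Relation.Unary.All as All
  open import Data.List.Relation.Unary.AllPairs using (_∷_)

  AtMostOneMissing : ∀ {n} → (Fin n → Set) → Subset n → Set
  AtMostOneMissing P p = ∀ {x y} → P x → P y → x ∉ p → y ∉ p → x ≡ y

  present-unless-equal : ∀ {n} {P : Fin n → Set} {p x g} → AtMostOneMissing P p →
    P x → P g → g ∉ p → x ≢ g → x ∈ p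
  present-unless-equal {p = p} {x} one Px Pg g∉p x≢g =
    decidable-stable (x ∈? p) (λ x∉p → x≢g (one Px Pg x∉p g∉p))

  present-of-two : ∀ {n} {P : Fin n → Set} {p x y} → AtMostOneMissing P p →
    P x → P y → x ≢ y → Σ[ z ∈ Fin n ] P z × z ∈ p
  present-of-two {p = p} {x} {y} one Px Py x≢y with x ∈? p | y ∈? p
  ... | yes x∈p | _       = x , Px , x∈p
  ... | no _    | yes y∈p = y , Py , y∈p
  ... | no x∉p  | no y∉p  = contradiction (one Px Py x∉p y∉p) x≢y

  x∉p-x : ∀ {n} (p : Subset n) x → x ∉ p - x
  x∉p-x (s ∷ p) zero    ()
  x∉p-x (s ∷ p) (suc x) (there x∈p-x) = x∉p-x p x x∈p-x

  ∈p-y⇒≢ : ∀ {n} {p : Subset n} {x y} → x ∈ p - y → x ≢ y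
  ∈p-y⇒≢ {p = p} {x} x∈p-x refl = x∉p-x p x x∈p-x

  p-y⊆p : ∀ {n} {p : Subset n} {x y} → x ∈ p - y → x ∈ p
  p-y⊆p {p = p} {y = y} = p─q⊆p p ⁅ y ⁆

  ∣p-x∣ : ∀ {n} {p : Subset n} {x} → x ∈ p → suc ∣ p - x ∣ ≡ ∣ p ∣
  ∣p-x∣ {p = inside  ∷ p} {zero}  here        = cong (suc ∘ ∣_∣) (p─⊥≡p p)
  ∣p-x∣ {p = inside  ∷ p} {suc x} (there x∈p) = cong suc (∣p-x∣ x∈p)
  ∣p-x∣ {p = outside ∷ p} {suc x} (there x∈p) = ∣p-x∣ x∈p

  remove-injective : ∀ {n} {p : Subset n} {x y} → x ∈ p → p - x ≡ p - y → x ≡ y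
  remove-injective {p = p} {x} {y} x∈p p-x≡p-y with x ≟ y
  ... | yes x≡y = x≡y
  ... | no x≢y  = contradiction (subst (x ∈_) (sym p-x≡p-y) (x∈p∧x≢y⇒x∈p-y x∈p x≢y)) (x∉p-x p x)

  smaller⇒≢ : ∀ {n} {p q : Subset n} → ∣ q ∣ < ∣ p ∣ → p ≢ q
  smaller⇒≢ ∣q∣<∣p∣ p≡q = <⇒≢ ∣q∣<∣p∣ (cong ∣_∣ (sym p≡q))

  module Enumeration {n : ℕ} (ε : Fin (suc n)) where

    coSingletons : List (Subset (suc n))
    coSingletons = map (⊤ -_) (allFin (suc n))

    -- The sets ⊤ - ε - g with g ≢ ε, indexing g ≢ ε by punchIn ε.
    coPairs : List (Subset (suc n))
    coPairs = map (λ h → ⊤ - ε - punchIn ε h) (allFin n)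

    allButOne : List (Subset (suc n))
    allButOne = ⊤ ∷ coSingletons

    allButOneNonIdentity : List (Subset (suc n))
    allButOneNonIdentity = ⊤ ∷ (coSingletons ++ coPairs)

    ∈⊤-g : ∀ {x g : Fin (suc n)} → x ≢ g → x ∈ ⊤ - g
    ∈⊤-g = x∈p∧x≢y⇒x∈p-y ∈⊤

    ∈⊤-ε-g : ∀ {x g : Fin (suc n)} → x ≢ ε → x ≢ g → x ∈ ⊤ - ε - g
    ∈⊤-ε-g x≢ε = x∈p∧x≢y⇒x∈p-y (∈⊤-g x≢ε)

    missing-from-⊤-g : ∀ {x g} → x ∉ ⊤ - g → x ≡ g
    missing-from-⊤-g {x} {g} x∉ = decidable-stable (x ≟ g) (x∉ ∘ ∈⊤-g)

    missing-from-⊤-ε-g : ∀ {x g} → x ≢ ε → x ∉ ⊤ - ε - g → x ≡ g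
    missing-from-⊤-ε-g {x} {g} x≢ε x∉ = decidable-stable (x ≟ g) (x∉ ∘ ∈⊤-ε-g x≢ε)

    coSingleton∈coSingletons : ∀ g → ⊤ - g ∈ₗ coSingletons
    coSingleton∈coSingletons g = ∈-map⁺ (⊤ -_) (∈-allFin g)

    coPair∈coPairs : ∀ {g} → g ≢ ε → ⊤ - ε - g ∈ₗ coPairs
    coPair∈coPairs g≢ε = subst (λ g → ⊤ - ε - g ∈ₗ coPairs) (punchIn-punchOut (g≢ε ∘ sym))
      (∈-map⁺ (λ h → ⊤ - ε - punchIn ε h) (∈-allFin _))

    ⊤-sound : ∀ {P : Fin (suc n) → Set} → AtMostOneMissing P ⊤
    ⊤-sound _ _ x∉⊤ _ = contradiction ∈⊤ x∉⊤

    coSingletons-sound : ∀ {P : Fin (suc n) → Set} {p} → p ∈ₗ coSingletons → AtMostOneMissing P p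
    coSingletons-sound p∈ with ∈-map⁻ (⊤ -_) {xs = allFin (suc n)} p∈
    ... | g , _ , refl = λ _ _ x∉ y∉ →
      trans (missing-from-⊤-g {g = g} x∉) (sym (missing-from-⊤-g {g = g} y∉))

    coPairs-sound : ∀ {p} → p ∈ₗ coPairs → AtMostOneMissing (_≢ ε) p
    coPairs-sound p∈ with ∈-map⁻ (λ h → ⊤ - ε - punchIn ε h) {xs = allFin n} p∈
    ... | h , _ , refl = λ x≢ε y≢ε x∉ y∉ →
      trans (missing-from-⊤-ε-g {g = punchIn ε h} x≢ε x∉) (sym (missing-from-⊤-ε-g {g = punchIn ε h} y≢ε y∉))

    allButOne-sound : ∀ {p} → p ∈ₗ allButOne → AtMostOneMissing (λ _ → Unit) p
    allButOne-sound (Any.here refl) = ⊤-sound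
    allButOne-sound (Any.there p∈)  = coSingletons-sound p∈

    allButOneNonIdentity-sound : ∀ {p} → p ∈ₗ allButOneNonIdentity → AtMostOneMissing (_≢ ε) p
    allButOneNonIdentity-sound (Any.here refl) = ⊤-sound
    allButOneNonIdentity-sound (Any.there p∈) with ∈-++⁻ coSingletons p∈
    ... | inj₁ p∈₁ = coSingletons-sound p∈₁
    ... | inj₂ p∈₂ = coPairs-sound p∈₂

    allButOne-complete : ∀ {p} → AtMostOneMissing (λ _ → Unit) p → p ∈ₗ allButOne
    allButOne-complete {p} one with any? (λ x → ¬? (x ∈? p))
    ... | no nothing-missing = Any.here (⊆-antisym (λ _ → ∈⊤) present)
      where
      present : ∀ {x} → x ∈ ⊤ → x ∈ p
      present {x} _ = decidable-stable (x ∈? p) (λ x∉p → nothing-missing (x , x∉p))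
    ... | yes (g , g∉p) = Any.there (subst (_∈ₗ coSingletons) (sym p≡⊤-g) (coSingleton∈coSingletons g))
      where
      p≡⊤-g : p ≡ ⊤ - g
      p≡⊤-g = ⊆-antisym (λ x∈p → ∈⊤-g (λ { refl → g∉p x∈p }))
                        (λ x∈ → present-unless-equal one _ _ g∉p (∈p-y⇒≢ x∈))

    allButOneNonIdentity-complete : ∀ {p} → AtMostOneMissing (_≢ ε) p → p ∈ₗ allButOneNonIdentity
    allButOneNonIdentity-complete {p} one
      with ε ∈? p | any? (λ x → ¬? (x ≟ ε) ×-dec ¬? (x ∈? p))
    ... | yes ε∈p | no nothing-missing = Any.here (⊆-antisym (λ _ → ∈⊤) present)
      where
      present : ∀ {x} → x ∈ ⊤ → x ∈ p
      present {x} _ with x ≟ ε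
      ... | yes refl = ε∈p
      ... | no x≢ε   = decidable-stable (x ∈? p) (λ x∉p → nothing-missing (x , x≢ε , x∉p))
    ... | yes ε∈p | yes (g , g≢ε , g∉p) =
      Any.there (∈-++⁺ˡ (subst (_∈ₗ coSingletons) (sym p≡⊤-g) (coSingleton∈coSingletons g)))
      where
      present : ∀ {x} → x ∈ ⊤ - g → x ∈ p
      present {x} x∈ with x ≟ ε
      ... | yes refl = ε∈p
      ... | no x≢ε   = present-unless-equal one x≢ε g≢ε g∉p (∈p-y⇒≢ x∈)
      p≡⊤-g : p ≡ ⊤ - g
      p≡⊤-g = ⊆-antisym (λ x∈p → ∈⊤-g (λ { refl → g∉p x∈p })) present
    ... | no ε∉p | no nothing-missing =
      Any.there (∈-++⁺ˡ (subst (_∈ₗ coSingletons) (sym p≡⊤-ε) (coSingleton∈coSingletons ε)))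
      where
      p≡⊤-ε : p ≡ ⊤ - ε
      p≡⊤-ε = ⊆-antisym (λ x∈p → ∈⊤-g (λ { refl → ε∉p x∈p }))
        (λ {x} x∈ → decidable-stable (x ∈? p) (λ x∉p → nothing-missing (x , ∈p-y⇒≢ x∈ , x∉p)))
    ... | no ε∉p | yes (g , g≢ε , g∉p) =
      Any.there (∈-++⁺ʳ coSingletons (subst (_∈ₗ coPairs) (sym p≡⊤-ε-g) (coPair∈coPairs g≢ε)))
      where
      p≡⊤-ε-g : p ≡ ⊤ - ε - g
      p≡⊤-ε-g = ⊆-antisym (λ x∈p → ∈⊤-ε-g (λ { refl → ε∉p x∈p }) (λ { refl → g∉p x∈p }))
        (λ x∈ → present-unless-equal one (∈p-y⇒≢ (p-y⊆p x∈)) g≢ε g∉p (∈p-y⇒≢ x∈))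

    length-coSingletons : length coSingletons ≡ suc n
    length-coSingletons = trans (length-map (⊤ -_) (allFin (suc n))) (length-tabulate (λ x → x))

    length-coPairs : length coPairs ≡ n
    length-coPairs = trans (length-map (λ h → ⊤ - ε - punchIn ε h) (allFin n)) (length-tabulate (λ x → x))

    ∣⊤∣ : ∣ ⊤ {suc n} ∣ ≡ suc n
    ∣⊤∣ = ∣⊤∣≡n (suc n)

    n<∣⊤∣ : n < ∣ ⊤ {suc n} ∣
    n<∣⊤∣ = subst (n <_) (sym ∣⊤∣) (n<1+n n)

    coSingleton-size : ∀ {p} → p ∈ₗ coSingletons → ∣ p ∣ ≡ n
    coSingleton-size p∈ with ∈-map⁻ (⊤ -_) {xs = allFin (suc n)} p∈
    ... | g , _ , refl = suc-injective (trans (∣p-x∣ {p = ⊤} {g} ∈⊤) ∣⊤∣)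

    coPair-size : ∀ {p} → p ∈ₗ coPairs → suc ∣ p ∣ ≡ n
    coPair-size p∈ with ∈-map⁻ (λ h → ⊤ - ε - punchIn ε h) {xs = allFin n} p∈
    ... | h , _ , refl = trans (∣p-x∣ {p = ⊤ - ε} {punchIn ε h} (∈⊤-g (punchInᵢ≢i ε h)))
                               (coSingleton-size (coSingleton∈coSingletons ε))

    -- No repetitions: within a family removal is injective, and different families
    -- have different sizes.
    coSingletons-unique : Unique coSingletons
    coSingletons-unique = Unique.map⁺ (remove-injective ∈⊤) (Unique.allFin⁺ (suc n))

    coPairs-unique : Unique coPairs
    coPairs-unique = Unique.map⁺
      (λ {h} {h′} e → punchIn-injective ε h h′ (remove-injective (∈⊤-g (punchInᵢ≢i ε h)) e))
      (Unique.allFin⁺ n)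

    ⊤∉coSingletons : ∀ {p} → p ∈ₗ coSingletons → ⊤ ≢ p
    ⊤∉coSingletons p∈ = smaller⇒≢ (subst (_< ∣ ⊤ {suc n} ∣) (sym (coSingleton-size p∈)) n<∣⊤∣)

    ⊤∉coPairs : ∀ {q} → q ∈ₗ coPairs → ⊤ ≢ q
    ⊤∉coPairs q∈ = smaller⇒≢ (<-trans (≤-reflexive (coPair-size q∈)) n<∣⊤∣)

    coSingletons∉coPairs : ∀ {p q} → p ∈ₗ coSingletons → q ∈ₗ coPairs → p ≢ q
    coSingletons∉coPairs p∈ q∈ = smaller⇒≢ (≤-reflexive (trans (coPair-size q∈) (sym (coSingleton-size p∈))))

    allButOne-unique : Unique allButOne
    allButOne-unique = All.tabulate ⊤∉coSingletons ∷ coSingletons-unique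

    allButOneNonIdentity-unique : Unique allButOneNonIdentity
    allButOneNonIdentity-unique = All.tabulate ⊤∉rest ∷ Unique.++⁺ coSingletons-unique coPairs-unique
      (λ (p∈ , p∈′) → coSingletons∉coPairs p∈ p∈′ refl)
      where
      ⊤∉rest : ∀ {p} → p ∈ₗ coSingletons ++ coPairs → ⊤ ≢ p
      ⊤∉rest p∈ with ∈-++⁻ coSingletons p∈
      ... | inj₁ p∈₁ = ⊤∉coSingletons p∈₁
      ... | inj₂ p∈₂ = ⊤∉coPairs p∈₂

module FinSelection where
  open import Data.Fin.Properties using (_≟_)

  avoid-two : ∀ {n} → 2 < n → (p q : Fin n) → Σ[ y ∈ Fin n ] y ≢ p × y ≢ q
  avoid-two {suc zero}       (s≤s ())
  avoid-two {suc (suc zero)} (s≤s (s≤s ()))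
  avoid-two {suc (suc (suc _))} _ p q with zero ≟ p | zero ≟ q
  ... | no 0≢p   | no 0≢q = zero , 0≢p , 0≢q
  ... | yes refl | _ with suc zero ≟ q
  ...   | no 1≢q   = suc zero , (λ ()) , 1≢q
  ...   | yes refl = suc (suc zero) , (λ ()) , (λ ())
  avoid-two {suc (suc (suc _))} _ p q | no _ | yes refl with suc zero ≟ p
  ...   | no 1≢p   = suc zero , 1≢p , (λ ())
  ...   | yes refl = suc (suc zero) , (λ ()) , (λ ())

module CommutingGraph {n : ℕ} (_∙_ : Op₂ (Fin n)) (ε : Fin n) (_⁻¹ : Op₁ (Fin n))
  (isAbelianGroup : IsAbelianGroup _≡_ _∙_ ε _⁻¹) (odd : ¬ (2 ∣ n)) where

  open import Data.Fin.Properties using (_≟_)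
  open import Data.Fin.Subset.Properties using (_∈?_)
  import Data.Bool.Properties as Bool
  open import Data.Product.Properties using (≡-dec)
  open import Data.Nat.Properties using (<-cmp)
  open import Relation.Binary.Definitions using (tri<; tri≈; tri>)
  open import Algebra.Bundles using (AbelianGroup)
  open MissingElements using (AtMostOneMissing; present-of-two)
  open FinSelection using (avoid-two)

  private
    G : AbelianGroup _ _
    G = record { isAbelianGroup = isAbelianGroup }
  open AbelianGroup G using (assoc; comm; inverseʳ; identityʳ; identityˡ; group)
  open import Algebra.Properties.Group group
    using (∙-cancelˡ; ε⁻¹≈ε; ⁻¹-involutive; ⁻¹-anti-homo-∙; x∙y⁻¹≈ε⇒x≈y)
  open Dihedral _∙_ _⁻¹

  -- A group of odd order has no element of order 2: right multiplication by such an
  -- element would be a fixed-point-free involution of the carrier.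
  self-inverse⇒ε : ∀ x → x ≡ x ⁻¹ → x ≡ ε
  self-inverse⇒ε x x≡x⁻¹ with x ≟ ε
  ... | yes x≡ε = x≡ε
  ... | no x≢ε  = contradiction
        (FixedPointFreeInvolution.involution⇒even n (_∙ x) twice-identity no-fixed-point) odd
    where
    twice-identity : ∀ y → (y ∙ x) ∙ x ≡ y
    twice-identity y = begin
      (y ∙ x) ∙ x       ≡⟨ assoc y x x ⟩
      y ∙ (x ∙ x)       ≡⟨ cong (λ z → y ∙ (x ∙ z)) x≡x⁻¹ ⟩
      y ∙ (x ∙ (x ⁻¹))  ≡⟨ cong (y ∙_) (inverseʳ x) ⟩
      y ∙ ε             ≡⟨ identityʳ y ⟩
      y                 ∎
      where open ≡-Reasoning
    no-fixed-point : ∀ y → y ∙ x ≢ y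
    no-fixed-point y y∙x≡y = x≢ε (∙-cancelˡ y x ε (trans y∙x≡y (sym (identityʳ y))))

  -- A rotation g commutes with a reflection h only if g = g⁻¹, i.e. g = ε.
  rotation-reflection-commute : ∀ g h → g ∙ h ≡ h ∙ (g ⁻¹) → g ≡ ε
  rotation-reflection-commute g h gh≡hg⁻¹ =
    self-inverse⇒ε g (∙-cancelˡ h g (g ⁻¹) (trans (comm h g) gh≡hg⁻¹))

  identity-reflection-commute : ∀ {g} h → g ≡ ε → g ∙ h ≡ h ∙ (g ⁻¹)
  identity-reflection-commute h refl = begin
    ε ∙ h        ≡⟨ identityˡ h ⟩
    h            ≡⟨ identityʳ h ⟨
    h ∙ ε        ≡⟨ cong (h ∙_) ε⁻¹≈ε ⟨
    h ∙ (ε ⁻¹)   ∎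
    where open ≡-Reasoning

  -- Reflections g, h commute only if g h⁻¹ is its own inverse, i.e. g = h.
  reflections-commute : ∀ g h → g ∙ (h ⁻¹) ≡ h ∙ (g ⁻¹) → g ≡ h
  reflections-commute g h e = x∙y⁻¹≈ε⇒x≈y g h (self-inverse⇒ε (g ∙ (h ⁻¹)) (trans e (sym inverse)))
    where
    inverse : (g ∙ (h ⁻¹)) ⁻¹ ≡ h ∙ (g ⁻¹)
    inverse = trans (⁻¹-anti-homo-∙ g (h ⁻¹)) (cong (_∙ (g ⁻¹)) (⁻¹-involutive h))

  isIdentity : Fin n → Bool
  isIdentity g = does (g ≟ ε)

  isIdentity-sound : ∀ {g} → isIdentity g ≡ true → g ≡ ε
  isIdentity-sound {g} e with g ≟ ε
  ... | yes g≡ε = g≡ε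
  isIdentity-sound () | no _

  adjacent : Vertex → Vertex → Bool
  adjacent (g , true)  (h , true)  = true
  adjacent (g , true)  (h , false) = isIdentity g
  adjacent (g , false) (h , true)  = isIdentity h
  adjacent (g , false) (h , false) = false

  commute⇒adjacent : ∀ u v → u ≢ v → u · v ≡ v · u → adjacent u v ≡ true
  commute⇒adjacent (g , true)  (h , true)  _   _ = refl
  commute⇒adjacent (g , true)  (h , false) _   e =
    dec-true (g ≟ ε) (rotation-reflection-commute g h (cong proj₁ e))
  commute⇒adjacent (g , false) (h , true)  _   e =
    dec-true (h ≟ ε) (rotation-reflection-commute h g (cong proj₁ (sym e)))
  commute⇒adjacent (g , false) (h , false) u≢v e =
    contradiction (cong (_, false) (reflections-commute g h (cong proj₁ e))) u≢v

  adjacent⇒commute : ∀ u v → adjacent u v ≡ true → u · v ≡ v · u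
  adjacent⇒commute (g , true)  (h , true)  _ = cong (_, true) (comm g h)
  adjacent⇒commute (g , true)  (h , false) e =
    cong (_, false) (identity-reflection-commute h (isIdentity-sound e))
  adjacent⇒commute (g , false) (h , true)  e =
    cong (_, false) (sym (identity-reflection-commute g (isIdentity-sound e)))

  Adj⇔adjacent : ∀ {u v} → Adj u v ⇔ (u ≢ v × adjacent u v ≡ true)
  Adj⇔adjacent {u} {v} = mk⇔
    (λ (u≢v , uv≡vu) → u≢v , commute⇒adjacent u v u≢v uv≡vu)
    (λ (u≢v , adj) → u≢v , adjacent⇒commute u v adj)

  edge : ∀ {u v} → u ≢ v → adjacent u v ≡ true → Adj u v
  edge u≢v adj = Equivalence.from Adj⇔adjacent (u≢v , adj)

  identity : Vertex
  identity = ε , true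

  identity-adjacentˡ : ∀ v → adjacent identity v ≡ true
  identity-adjacentˡ (h , true)  = refl
  identity-adjacentˡ (h , false) = dec-true (ε ≟ ε) refl

  identity-adjacentʳ : ∀ v → adjacent v identity ≡ true
  identity-adjacentʳ (h , true)  = refl
  identity-adjacentʳ (h , false) = dec-true (ε ≟ ε) refl

  _≟V_ : (u v : Vertex) → Dec (u ≡ v)
  _≟V_ = ≡-dec _≟_ Bool._≟_

  offDistance : Bool → ℕ
  offDistance true  = 1
  offDistance false = 2

  -- Shortest-path distance in Γ, which has diameter 2 thanks to the universal vertex.
  distance : Vertex → Vertex → ℕ
  distance u v = if does (u ≟V v) then 0 else offDistance (adjacent u v)

  distance-self : ∀ u → distance u u ≡ 0
  distance-self u = cong (if_then 0 else offDistance (adjacent u u)) (dec-true (u ≟V u) refl)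

  distance-off : ∀ {u v} → u ≢ v → distance u v ≡ offDistance (adjacent u v)
  distance-off {u} {v} u≢v = cong (if_then 0 else offDistance (adjacent u v)) (dec-false (u ≟V v) u≢v)

  distance≡0 : ∀ {u v} → distance u v ≡ 0 → u ≡ v
  distance≡0 {u} {v} d≡0 with u ≟V v | adjacent u v
  ... | yes u≡v | _ = u≡v
  distance≡0 () | no _ | true
  distance≡0 () | no _ | false

  walk-length-0 : ∀ {u v} → Walk u v 0 → u ≡ v
  walk-length-0 here = refl

  walk-length-1 : ∀ {u v} → Walk u v 1 → adjacent u v ≡ true
  walk-length-1 (step u~v here) = proj₂ (Equivalence.to Adj⇔adjacent u~v)

  -- A walk of length `distance u v`: direct, or through the identity.
  distance-walk : ∀ u v → Walk u v (distance u v)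
  distance-walk u v with u ≟V v | adjacent u v in adj
  ... | yes refl | _     = here
  ... | no u≢v   | true  = step (edge u≢v adj) here
  ... | no u≢v   | false = step (edge u≢identity (identity-adjacentʳ u))
                            (step (edge identity≢v (identity-adjacentˡ v)) here)
    where
    u≢identity : u ≢ identity
    u≢identity refl with () ← trans (sym adj) (identity-adjacentˡ v)
    identity≢v : identity ≢ v
    identity≢v refl with () ← trans (sym adj) (identity-adjacentʳ u)

  distance-minimal : ∀ u v m → m < distance u v → ¬ Walk u v m
  distance-minimal u v m m<d w with u ≟V v | adjacent u v in adj
  distance-minimal u v zero          _              w | no u≢v | _     = u≢v (walk-length-0 w)
  distance-minimal u v (suc zero)    _              w | no _   | false with () ← trans (sym adj) (walk-length-1 w)
  distance-minimal u v (suc zero)    (s≤s ())       w | no _   | true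
  distance-minimal u v (suc (suc m)) (s≤s (s≤s ())) w | no _   | false
  distance-minimal u v (suc (suc m)) (s≤s ())       w | no _   | true

  Dist-unique : ∀ {u v k l} → Dist u v k → Dist u v l → k ≡ l
  Dist-unique {k = k} {l} (walk-k , min-k) (walk-l , min-l) with <-cmp k l
  ... | tri< k<l _ _ = contradiction walk-k (min-l k k<l)
  ... | tri≈ _ k≡l _ = k≡l
  ... | tri> _ _ l<k = contradiction walk-l (min-k l l<k)

  Dist⇔distance : ∀ {u v k} → Dist u v k ⇔ k ≡ distance u v
  Dist⇔distance {u} {v} = mk⇔
    (λ d → Dist-unique d (distance-walk u v , distance-minimal u v))
    (λ { refl → distance-walk u v , distance-minimal u v })

  ResolvingByDistance : VSet → Set
  ResolvingByDistance W = ∀ u v → (∀ w → w ∈V W → distance u w ≡ distance v w) → u ≡ v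

  Resolving⇔ResolvingByDistance : ∀ W → Resolving W ⇔ ResolvingByDistance W
  Resolving⇔ResolvingByDistance W = mk⇔
    (λ resolves u v same → resolves u v λ w w∈W k → mk⇔
      (λ d → Equivalence.from Dist⇔distance (trans (Equivalence.to Dist⇔distance d) (same w w∈W)))
      (λ d → Equivalence.from Dist⇔distance (trans (Equivalence.to Dist⇔distance d) (sym (same w w∈W)))))
    (λ resolves u v same → resolves u v λ w w∈W → Equivalence.to Dist⇔distance
      (Equivalence.to (same w w∈W (distance u w)) (distance-walk u w , distance-minimal u w)))

  _∈V?_ : ∀ u W → Dec (u ∈V W)
  (g , true)  ∈V? (A , B) = g ∈? A
  (g , false) ∈V? (A , B) = g ∈? B

  ∉V⇒≢ : ∀ {u w W} → ¬ (u ∈V W) → w ∈V W → u ≢ w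
  ∉V⇒≢ u∉W w∈W refl = u∉W w∈W

  twins-unresolved : ∀ W {u v} → ¬ (u ∈V W) → ¬ (v ∈V W) → (∀ w → adjacent u w ≡ adjacent v w) →
    ∀ w → w ∈V W → distance u w ≡ distance v w
  twins-unresolved W {u} {v} u∉W v∉W same-neighbours w w∈W = begin
    distance u w                 ≡⟨ distance-off (∉V⇒≢ {W = W} u∉W w∈W) ⟩
    offDistance (adjacent u w)   ≡⟨ cong offDistance (same-neighbours w) ⟩
    offDistance (adjacent v w)   ≡⟨ distance-off (∉V⇒≢ {W = W} v∉W w∈W) ⟨
    distance v w                 ∎
    where open ≡-Reasoning

  -- Necessity: non-identity rotations are pairwise twins, so a resolving set misses
  -- at most one of them ...
  resolving⇒rotations : ∀ {a b} → ResolvingByDistance (a , b) → AtMostOneMissing (_≢ ε) a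
  resolving⇒rotations {a} {b} resolves {x} {y} x≢ε y≢ε x∉a y∉a =
    cong proj₁ (resolves (x , true) (y , true)
      (twins-unresolved (a , b) {x , true} {y , true} x∉a y∉a same-neighbours))
    where
    same-neighbours : ∀ w → adjacent (x , true) w ≡ adjacent (y , true) w
    same-neighbours (h , true)  = refl
    same-neighbours (h , false) = trans (dec-false (x ≟ ε) x≢ε) (sym (dec-false (y ≟ ε) y≢ε))

  -- ... and reflections are pairwise twins, so it misses at most one of them.
  resolving⇒reflections : ∀ {a b} → ResolvingByDistance (a , b) → AtMostOneMissing (λ _ → Unit) b
  resolving⇒reflections {a} {b} resolves {x} {y} _ _ x∉b y∉b =
    cong proj₁ (resolves (x , false) (y , false)
      (twins-unresolved (a , b) {x , false} {y , false} x∉b y∉b same-neighbours))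
    where
    same-neighbours : ∀ w → adjacent (x , false) w ≡ adjacent (y , false) w
    same-neighbours (h , true)  = refl
    same-neighbours (h , false) = refl

  -- Distances of a vertex to a non-identity rotation and to a reflection (both other
  -- than the vertex itself): (1,1) for the identity, (1,2) for other rotations and
  -- (2,2) for reflections.
  profile : Vertex → ℕ × ℕ
  profile (g , true)  = 1 , offDistance (isIdentity g)
  profile (h , false) = 2 , 2

  landmark-profile : ∀ {g₀ h₀} → g₀ ≢ ε → ∀ u → u ≢ (g₀ , true) → u ≢ (h₀ , false) →
    (distance u (g₀ , true) , distance u (h₀ , false)) ≡ profile u
  landmark-profile _ u@(g , true) u≢ρ u≢r = cong₂ _,_ (distance-off u≢ρ) (distance-off u≢r)
  landmark-profile {g₀} g₀≢ε u@(h , false) u≢ρ u≢r =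
    cong₂ _,_ (trans (distance-off u≢ρ) (cong offDistance (dec-false (g₀ ≟ ε) g₀≢ε))) (distance-off u≢r)

  profile-injective : ∀ {a b} → AtMostOneMissing (_≢ ε) a → AtMostOneMissing (λ _ → Unit) b →
    ∀ u v → ¬ (u ∈V (a , b)) → ¬ (v ∈V (a , b)) → profile u ≡ profile v → u ≡ v
  profile-injective rotations _ (g , true) (g′ , true) g∉a g′∉a same
    with g ≟ ε | g′ ≟ ε | cong proj₂ same
  ... | yes refl | yes refl | _ = refl
  ... | no g≢ε   | no g′≢ε  | _ = cong (_, true) (rotations g≢ε g′≢ε g∉a g′∉a)
  ... | yes _    | no _     | ()
  ... | no _     | yes _    | ()
  profile-injective _ reflections (h , false) (h′ , false) h∉b h′∉b _ =
    cong (_, false) (reflections _ _ h∉b h′∉b)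
  profile-injective _ _ (g , true)  (h , false) _ _ ()
  profile-injective _ _ (h , false) (g , true)  _ _ ()

  -- A vertex in W is recognised by its zero distance to itself; two vertices outside
  -- W are told apart by their distances to landmarks (g₀,1), g₀ ≠ ε, and (h₀,-1) in W.
  landmarks⇒resolving : ∀ {a b g₀ h₀} → AtMostOneMissing (_≢ ε) a → AtMostOneMissing (λ _ → Unit) b →
    g₀ ≢ ε → g₀ ∈ a → h₀ ∈ b → ResolvingByDistance (a , b)
  landmarks⇒resolving {a} {b} {g₀} {h₀} rotations reflections g₀≢ε g₀∈a h₀∈b u v same
    with u ∈V? (a , b) | v ∈V? (a , b)
  ... | yes u∈W | _       = sym (distance≡0 (trans (sym (same u u∈W)) (distance-self u)))
  ... | no _    | yes v∈W = distance≡0 (trans (same v v∈W) (distance-self v))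
  ... | no u∉W  | no v∉W  = profile-injective rotations reflections u v u∉W v∉W (begin
    profile u
      ≡⟨ landmark-profile g₀≢ε u (∉V⇒≢ u∉W g₀∈a) (∉V⇒≢ u∉W h₀∈b) ⟨
    (distance u (g₀ , true) , distance u (h₀ , false))
      ≡⟨ cong₂ _,_ (same (g₀ , true) g₀∈a) (same (h₀ , false) h₀∈b) ⟩
    (distance v (g₀ , true) , distance v (h₀ , false))
      ≡⟨ landmark-profile g₀≢ε v (∉V⇒≢ v∉W g₀∈a) (∉V⇒≢ v∉W h₀∈b) ⟩
    profile v ∎)
    where open ≡-Reasoning

  -- Sufficiency for n ≥ 3: two distinct non-identity elements exist, so W contains a
  -- non-identity rotation and a reflection to serve as landmarks.
  rotations∧reflections⇒resolving : 2 < n → ∀ {a b} →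
    AtMostOneMissing (_≢ ε) a → AtMostOneMissing (λ _ → Unit) b → ResolvingByDistance (a , b)
  rotations∧reflections⇒resolving 2<n rotations reflections
    with avoid-two 2<n ε ε
  ... | x , x≢ε , _ with avoid-two 2<n ε x
  ... | y , y≢ε , y≢x
    with present-of-two rotations x≢ε y≢ε (y≢x ∘ sym) | present-of-two reflections _ _ (x≢ε ∘ sym)
  ... | g₀ , g₀≢ε , g₀∈a | h₀ , _ , h₀∈b = landmarks⇒resolving rotations reflections g₀≢ε g₀∈a h₀∈b

module ResolvingSetCount (m : ℕ) (_∙_ : Op₂ (Fin (3 + m))) (ε : Fin (3 + m)) (_⁻¹ : Op₁ (Fin (3 + m)))
  (isAbelianGroup : IsAbelianGroup _≡_ _∙_ ε _⁻¹) (odd : ¬ (2 ∣ 3 + m)) where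

  open import Data.Nat.Properties using (_≟_; suc-injective)
  open import Data.Nat.ListAction using (sum)
  open import Data.List.Membership.Propositional.Properties
    using (∈-filter⁺; ∈-filter⁻; ∈-cartesianProduct⁺; ∈-cartesianProduct⁻)
  open Dihedral _∙_ _⁻¹
  open CommutingGraph _∙_ ε _⁻¹ isAbelianGroup odd
  open MissingElements.Enumeration ε
  open Coefficients
  open ListSums

  candidates : List VSet
  candidates = cartesianProduct allButOneNonIdentity allButOne

  candidates-unique : Unique candidates
  candidates-unique = Unique.cartesianProduct⁺ allButOneNonIdentity-unique allButOne-unique

  candidate⇔resolving : ∀ W → W ∈ₗ candidates ⇔ Resolving W
  candidate⇔resolving W = mk⇔
    (λ W∈ → let a∈ , b∈ = ∈-cartesianProduct⁻ allButOneNonIdentity allButOne W∈ in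
      Equivalence.from (Resolving⇔ResolvingByDistance W)
        (rotations∧reflections⇒resolving (s≤s (s≤s (s≤s z≤n)))
          (allButOneNonIdentity-sound a∈) (allButOne-sound b∈)))
    (λ resolves → let resolves′ = Equivalence.to (Resolving⇔ResolvingByDistance W) resolves in
      ∈-cartesianProduct⁺ (allButOneNonIdentity-complete (resolving⇒rotations resolves′))
                          (allButOne-complete (resolving⇒reflections resolves′)))

  resolvingSetsOfSize : ℕ → List VSet
  resolvingSetsOfSize i = filter (λ W → size W ≟ i) candidates

  reflection-sum : ∀ i s → sum (map (λ b → δ i (s + ∣ b ∣)) allButOne) ≡ reflectionRow m i s
  reflection-sum i s = cong₂ _+_ (cong (λ k → δ i (s + k)) ∣⊤∣) (begin
    sum (map (λ b → δ i (s + ∣ b ∣)) coSingletons)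
      ≡⟨ sum-map-const coSingletons (cong (λ k → δ i (s + k)) ∘ coSingleton-size) ⟩
    length coSingletons * δ i (s + (2 + m))
      ≡⟨ cong (_* δ i (s + (2 + m))) length-coSingletons ⟩
    (3 + m) * δ i (s + (2 + m)) ∎)
    where open ≡-Reasoning

  rotation-sum : ∀ i → sum (map (λ a → reflectionRow m i ∣ a ∣) allButOneNonIdentity) ≡ pairCount m i
  rotation-sum i = cong₂ _+_ (cong row ∣⊤∣) (begin
    sum (map (row ∘ ∣_∣) (coSingletons ++ coPairs))
      ≡⟨ sum-map-++ (row ∘ ∣_∣) coSingletons coPairs ⟩
    sum (map (row ∘ ∣_∣) coSingletons) + sum (map (row ∘ ∣_∣) coPairs)
      ≡⟨ cong₂ _+_ (sum-map-const coSingletons (cong row ∘ coSingleton-size))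
                   (sum-map-const coPairs (cong row ∘ suc-injective ∘ coPair-size)) ⟩
    length coSingletons * row (2 + m) + length coPairs * row (1 + m)
      ≡⟨ cong₂ (λ k l → k * row (2 + m) + l * row (1 + m)) length-coSingletons length-coPairs ⟩
    (3 + m) * row (2 + m) + (2 + m) * row (1 + m) ∎)
    where
    open ≡-Reasoning
    row : ℕ → ℕ
    row = reflectionRow m i

  count : ∀ i → length (resolvingSetsOfSize i) ≡ pairCount m i
  count i = begin
    length (filter (λ W → size W ≟ i) candidates)
      ≡⟨ length-filter≡sum (λ W → size W ≟ i) candidates ⟩
    sum (map (λ W → δ i (size W)) candidates)
      ≡⟨ sum-cartesianProduct (λ W → δ i (size W)) allButOneNonIdentity allButOne ⟩
    sum (map (λ a → sum (map (λ b → δ i (∣ a ∣ + ∣ b ∣)) allButOne)) allButOneNonIdentity)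
      ≡⟨ sum-map-cong allButOneNonIdentity (λ {a} _ → reflection-sum i ∣ a ∣) ⟩
    sum (map (λ a → reflectionRow m i ∣ a ∣) allButOneNonIdentity)
      ≡⟨ rotation-sum i ⟩
    pairCount m i ∎
    where open ≡-Reasoning

  numResolvingSets : ∀ i → NumResolvingSets i (pairCount m i)
  numResolvingSets i =
    resolvingSetsOfSize i ,
    Unique.filter⁺ (λ W → size W ≟ i) candidates-unique ,
    (λ W → mk⇔
      (λ W∈ → let W∈candidates , size≡i = ∈-filter⁻ (λ W → size W ≟ i) {xs = candidates} W∈ in
        Equivalence.to (candidate⇔resolving W) W∈candidates , size≡i)
      (λ (resolves , size≡i) →
        ∈-filter⁺ (λ W → size W ≟ i) (Equivalence.from (candidate⇔resolving W) resolves) size≡i)) ,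
    count i

-- n ≥ 3 because n > 1 is odd; the count of resolving sets of size i is then the
-- coefficient of x^i in the claimed polynomial.
theorem4p3 : (n : ℕ) (_∙_ : Op₂ (Fin n)) (ε : Fin n) (_⁻¹ : Op₁ (Fin n)) →
    IsAbelianGroup _≡_ _∙_ ε _⁻¹ → 1 < n → ¬ (2 ∣ n) →
    ∀ (i : ℕ) → Dihedral.NumResolvingSets _∙_ _⁻¹ i (coeff (resolvingPolyRHS n) i)
theorem4p3 (suc (suc (suc m))) _∙_ ε _⁻¹ isAbelianGroup _ odd i =
  subst (Dihedral.NumResolvingSets _∙_ _⁻¹ i) (Coefficients.pairCount≡coeff m i)
    (ResolvingSetCount.numResolvingSets m _∙_ ε _⁻¹ isAbelianGroup odd i)
theorem4p3 (suc (suc zero)) _ _ _ _ _ odd _ = contradiction (divides 1 refl) odd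
theorem4p3 (suc zero) _ _ _ _ (s≤s ()) _ _
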